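{- Let $n\in\mathbb{N}$, $n\geq 9$, and let $G=C_n(\{1,4,n-4,n-1\})$. Then $\lambda_{(3,2,1)}(G)\geq 15$.
   Context: For $n\ge 3$ and $S\subseteq\{1,\dots,n-1\}$ closed under $x\mapsto n-x$, the circulant $C_n(S)$ is the graph with vertex set $\{u_1,\dots,u_n\}$ in which $u_iu_j$ is an edge iff $|i-j|\in S$. An $L(3,2,1)$-labeling of a graph $G$ is a function $f:V(G)\to\mathbb{N}\cup\{0\}$ such that $|f(x)-f(y)|>3-\operatorname{dist}_G(x,y)$ for all distinct $x,y\in V(G)$. $\lambda_{(3,2,1)}(G)$ is the minimum, over all $L(3,2,1)$-labelings of $G$, of the difference between the largest and smallest label used. -}

module Defs where

open import Data.Nat using (ℕ; zero; suc; _+_; _∸_; _≤_; _<_; ∣_-_∣)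
open import Data.Fin using (Fin; toℕ)
open import Data.Product using (Σ; _×_; _,_)
open import Data.Sum using (_⊎_)
open import Relation.Binary.PropositionalEquality using (_≡_)
open import Relation.Nullary using (¬_)

Graph : ℕ → Set₁
Graph n = Fin n → Fin n → Set

-- Circulant C_n({1,4,n-4,n-1}): vertices u_1..u_n represented by Fin n
-- (u_{i+1} ↦ i); u_i u_j adjacent iff |i - j| ∈ {1, 4, n-4, n-1}.
C14 : (n : ℕ) → Graph n
C14 n x y = let d = ∣ toℕ x - toℕ y ∣ in
  (d ≡ 1) ⊎ (d ≡ 4) ⊎ (d ≡ n ∸ 4) ⊎ (d ≡ n ∸ 1)

data Walk {n : ℕ} (G : Graph n) : Fin n → Fin n → ℕ → Set where
  here  : ∀ {x} → Walk G x x 0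
  step  : ∀ {x y z k} → G x y → Walk G y z k → Walk G x z (suc k)

Dist : {n : ℕ} → Graph n → Fin n → Fin n → ℕ → Set
Dist G x y d = Walk G x y d × (∀ k → Walk G x y k → d ≤ k)

-- L(3,2,1)-labeling: |f(x) - f(y)| > 3 - dist(x,y) for distinct x, y,
-- i.e. (in ℕ, avoiding negatives) 3 < |f(x) - f(y)| + dist(x,y).
IsL321 : {n : ℕ} → Graph n → (Fin n → ℕ) → Set
IsL321 {n} G f = ∀ (x y : Fin n) → ¬ (x ≡ y) → ∀ d → Dist G x y d →
  3 < ∣ f x - f y ∣ + d

{-# OPTIONS --safe #-}
module Submission where

open import Defs
open import Data.Nat using (ℕ; _≤_; _+_)
open import Data.Fin using (Fin)
open import Data.Product using (Σ)

open import Data.Bool using (Bool; true; false; T; if_then_else_; _∧_)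
open import Data.Bool.ListAction using (all; any)
open import Data.Bool.Properties using (T-∧; T-≡)
open import Data.Empty using (⊥-elim)
open import Data.Fin as Fin using (toℕ; fromℕ<)
open import Data.Fin.Properties using (any?; toℕ<n; toℕ-fromℕ<; toℕ-injective)
open import Data.List using (List; []; _∷_; upTo; applyDownFrom; allFin)
open import Data.List.Extrema.Nat using (argmin; argmax; f[argmin]≤f[xs]; f[xs]≤f[argmax])
open import Data.List.Membership.Propositional using (find)
open import Data.List.Membership.Propositional.Properties using (∈-upTo⁺; ∈-upTo⁻; ∈-allFin)
import Data.List.Relation.Unary.All as All
open import Data.List.Relation.Unary.All.Properties using (all⁺)
open import Data.List.Relation.Unary.Any.Properties using (any⁻)
open import Data.Nat as ℕ
  using (suc; zero; _∸_; _<_; _⊔_; ∣_-_∣; _≤ᵇ_; _≡ᵇ_; NonZero; _%_; _≤?_; _<?_; s≤s; z≤n; z<s)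
open import Data.Nat.DivMod using (_mod_; m%n<n; m<n⇒m%n≡m; %-distribˡ-+; m≤n⇒[n∸m]%m≡n%m)
open import Data.Nat.Induction using (<-rec)
open import Data.Nat.Properties
open import Data.Product using (_×_; _,_; ∃; proj₁; proj₂)
open import Data.Sum using (_⊎_; inj₁; inj₂; [_,_]′)
open import Function using (_∘_; _$_; id; Equivalence)
open import Relation.Binary.PropositionalEquality
open import Relation.Nullary using (¬_; Dec; yes; no)
open import Relation.Nullary.Decidable using (map′; _×-dec_; _⊎-dec_; toWitness; isYes)
open import Relation.Unary using (Decidable)

-- Let v be a vertex of minimum label μ and suppose that all labels lie in
-- [μ, μ + 15).  Rotate the circulant so that v sits at position 0 and look at
-- a window of consecutive positions: 0, …, 13 with jumps ±1, ±4 when n ≥ 14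
-- (these are edges of C_n for every n), and the whole of C_n when n ≤ 13.
-- A walk of length l ≤ 3 inside the window bounds the distance of its ends,
-- so their labels differ by at least 4 − l.  A backtracking search shows that
-- no labelling of the window by 0, …, 14 with 0 at position 0 meets all these
-- constraints.

module _ {n : ℕ} {G : Graph n} (G? : ∀ x y → Dec (G x y)) where

  walk? : ∀ k x y → Dec (Walk G x y k)
  walk? zero x y =
    map′ (λ { refl → here }) (λ { here → refl }) (x Fin.≟ y)
  walk? (suc k) x y =
    map′ (λ (z , xz , zy) → step xz zy) (λ { (step xz zy) → _ , xz , zy })
         (any? (λ z → G? x z ×-dec walk? k z y))

  -- IsL321 constrains only pairs at a known distance: the distance is realised
  -- by a shortest walk, found by deciding whether a shorter walk exists.
  IsL321⇒walk-gap : ∀ {f x y} → IsL321 G f → x ≢ y →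
                    ∀ k → Walk G x y k → 3 < ∣ f x - f y ∣ + k
  IsL321⇒walk-gap {f} {x} {y} L x≢y = <-rec _ gap
    where
      gap : ∀ k → (∀ {j} → j < k → Walk G x y j → 3 < ∣ f x - f y ∣ + j) →
            Walk G x y k → 3 < ∣ f x - f y ∣ + k
      gap k shorter w with any? (λ (j : Fin k) → walk? (toℕ j) x y)
      ... | yes (j , wj) =
        <-≤-trans (shorter (toℕ<n j) wj) (+-monoʳ-≤ _ (<⇒≤ (toℕ<n j)))
      ... | no none = L x y x≢y k (w , minimal)
        where
          minimal : ∀ j → Walk G x y j → k ≤ j
          minimal j wj = ≮⇒≥ λ j<k →
            none (fromℕ< j<k , subst (Walk G x y) (sym (toℕ-fromℕ< j<k)) wj)

Jump : ℕ → ℕ → Set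
Jump n d = (d ≡ 1) ⊎ (d ≡ 4) ⊎ (d ≡ n ∸ 4) ⊎ (d ≡ n ∸ 1)

jump? : ∀ n → Decidable (Jump n)
jump? n d = (d ℕ.≟ 1) ⊎-dec (d ℕ.≟ 4) ⊎-dec (d ℕ.≟ n ∸ 4) ⊎-dec (d ℕ.≟ n ∸ 1)

C14? : ∀ n x y → Dec (C14 n x y)
C14? n x y = jump? n ∣ toℕ x - toℕ y ∣

Jump-complement : ∀ {n d} → 4 ≤ n → Jump n d → Jump n (n ∸ d)
Jump-complement 4≤n (inj₁ refl)               = inj₂ (inj₂ (inj₂ refl))
Jump-complement 4≤n (inj₂ (inj₁ refl))        = inj₂ (inj₂ (inj₁ refl))
Jump-complement 4≤n (inj₂ (inj₂ (inj₁ refl))) = inj₂ (inj₁ (m∸[m∸n]≡n 4≤n))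
Jump-complement 4≤n (inj₂ (inj₂ (inj₂ refl))) =
  inj₁ (m∸[m∸n]≡n (≤-trans (s≤s z≤n) 4≤n))

Short : ℕ → Set
Short d = (d ≡ 1) ⊎ (d ≡ 4)

short? : Decidable Short
short? d = (d ℕ.≟ 1) ⊎-dec (d ℕ.≟ 4)

Short⇒Jump : ∀ {n d} → Short d → Jump n d
Short⇒Jump (inj₁ d≡1) = inj₁ d≡1
Short⇒Jump (inj₂ d≡4) = inj₂ (inj₁ d≡4)

EqOrComplement : ℕ → ℕ → ℕ → Set
EqOrComplement n x y = x ≡ y ⊎ x ≡ n ∸ y

∣m-[m+d]%n∣ : ∀ {m d n} .{{_ : NonZero n}} → m < n → d < n →
              EqOrComplement n ∣ m - (m + d) % n ∣ d
∣m-[m+d]%n∣ {m} {d} {n} m<n d<n with m + d <? n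
... | yes m+d<n = inj₁ (trans (cong (∣_-_∣ m) (m<n⇒m%n≡m m+d<n)) (∣m-m+n∣≡n m d))
... | no m+d≮n = inj₂ $ begin
  ∣ m - (m + d) % n ∣           ≡⟨ cong (∣_-_∣ m) wrapped ⟩
  ∣ m - r ∣                     ≡⟨ cong (∣_- r ∣) m≡r+[n∸d] ⟩
  ∣ r + (n ∸ d) - r ∣           ≡⟨ ∣-∣-comm (r + (n ∸ d)) r ⟩
  ∣ r - r + (n ∸ d) ∣           ≡⟨ ∣m-m+n∣≡n r (n ∸ d) ⟩
  n ∸ d                         ∎
  where
    open ≡-Reasoning
    n≤m+d = ≮⇒≥ m+d≮n
    r = m + d ∸ n
    wrapped : (m + d) % n ≡ r
    wrapped = trans (sym (m≤n⇒[n∸m]%m≡n%m n≤m+d))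
                    (m<n⇒m%n≡m (m<n+o⇒m∸n<o (m + d) n (+-mono-< m<n d<n)))
    m≡r+[n∸d] : m ≡ r + (n ∸ d)
    m≡r+[n∸d] = +-cancelʳ-≡ d m (r + (n ∸ d)) $ begin
      m + d                 ≡⟨ m∸n+n≡m n≤m+d ⟨
      r + n                 ≡⟨ cong (r +_) (m∸n+n≡m (<⇒≤ d<n)) ⟨
      r + (n ∸ d + d)       ≡⟨ +-assoc r (n ∸ d) d ⟨
      r + (n ∸ d) + d       ∎

module Rotation (n : ℕ) .{{_ : NonZero n}} (v : Fin n) where

  rotate : ℕ → Fin n
  rotate a = (toℕ v + a) mod n

  toℕ-rotate : ∀ a → toℕ (rotate a) ≡ (toℕ v + a) % n
  toℕ-rotate a = toℕ-fromℕ< (m%n<n (toℕ v + a) n)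

  rotate-zero : rotate 0 ≡ v
  rotate-zero = toℕ-injective $ begin
    toℕ (rotate 0)      ≡⟨ toℕ-rotate 0 ⟩
    (toℕ v + 0) % n     ≡⟨ cong (_% n) (+-identityʳ (toℕ v)) ⟩
    toℕ v % n           ≡⟨ m<n⇒m%n≡m (toℕ<n v) ⟩
    toℕ v               ∎
    where open ≡-Reasoning

  toℕ-rotate-+ : ∀ {a d} → d < n → toℕ (rotate (a + d)) ≡ (toℕ (rotate a) + d) % n
  toℕ-rotate-+ {a} {d} d<n = begin
    toℕ (rotate (a + d))            ≡⟨ toℕ-rotate (a + d) ⟩
    (toℕ v + (a + d)) % n           ≡⟨ cong (_% n) (+-assoc (toℕ v) a d) ⟨
    (toℕ v + a + d) % n             ≡⟨ %-distribˡ-+ (toℕ v + a) d n ⟩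
    ((toℕ v + a) % n + d % n) % n   ≡⟨ cong₂ (λ x y → (x + y) % n)
                                               (sym (toℕ-rotate a)) (m<n⇒m%n≡m d<n) ⟩
    (toℕ (rotate a) + d) % n        ∎
    where open ≡-Reasoning

  ∣rotate-rotate∣-≤ : ∀ {a c} → a ≤ c → c < n →
                      EqOrComplement n ∣ toℕ (rotate a) - toℕ (rotate c) ∣ ∣ a - c ∣
  ∣rotate-rotate∣-≤ {a} {c} a≤c c<n with c ∸ a | m+[n∸m]≡n a≤c | m∸n≤m c a
  ... | d | refl | d≤c rewrite ∣m-m+n∣≡n a d | toℕ-rotate-+ {a} (≤-<-trans d≤c c<n) =
    ∣m-[m+d]%n∣ (toℕ<n (rotate a)) (≤-<-trans d≤c c<n)

  ∣rotate-rotate∣ : ∀ {a c} → a < n → c < n →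
                    EqOrComplement n ∣ toℕ (rotate a) - toℕ (rotate c) ∣ ∣ a - c ∣
  ∣rotate-rotate∣ {a} {c} a<n c<n with ≤-total a c
  ... | inj₁ a≤c = ∣rotate-rotate∣-≤ a≤c c<n
  ... | inj₂ c≤a = subst₂ (EqOrComplement n)
                          (∣-∣-comm (toℕ (rotate c)) (toℕ (rotate a))) (∣-∣-comm c a)
                          (∣rotate-rotate∣-≤ c≤a a<n)

  rotate-injective : ∀ {a c} → a < n → c < n → rotate a ≡ rotate c → a ≡ c
  rotate-injective {a} {c} a<n c<n ra≡rc =
    [ (λ gap≡δ → ∣m-n∣≡0⇒m≡n (trans (sym gap≡δ) gap≡0))
    , (λ gap≡n∸δ → ⊥-elim (<⇒≢ (m<n⇒0<n∸m δ<n) (trans (sym gap≡0) gap≡n∸δ)))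
    ]′ (∣rotate-rotate∣ a<n c<n)
    where
      gap≡0 : ∣ toℕ (rotate a) - toℕ (rotate c) ∣ ≡ 0
      gap≡0 rewrite ra≡rc = ∣n-n∣≡0 (toℕ (rotate c))
      δ<n : ∣ a - c ∣ < n
      δ<n = ≤-<-trans (∣m-n∣≤m⊔n a c) (⊔-lub a<n c<n)

  rotate-Jump⇒C14 : 4 ≤ n → ∀ {a c} → a < n → c < n →
                    Jump n ∣ a - c ∣ → C14 n (rotate a) (rotate c)
  rotate-Jump⇒C14 4≤n a<n c<n jump =
    [ (λ gap≡δ → subst (Jump n) (sym gap≡δ) jump)
    , (λ gap≡n∸δ → subst (Jump n) (sym gap≡n∸δ) (Jump-complement 4≤n jump))
    ]′ (∣rotate-rotate∣ a<n c<n)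

module Window {D : ℕ → Set} (D? : Decidable D) (m : ℕ) where

  reachable : ℕ → ℕ → ℕ → Bool
  reachable zero    a b = a ≡ᵇ b
  reachable (suc l) a b = any (λ c → isYes (D? ∣ a - c ∣) ∧ reachable l c b) (upTo m)

  demand : ℕ → ℕ → ℕ → ℕ
  demand l a b = if reachable l a b then 4 ∸ l else 0

  separation : ℕ → ℕ → ℕ
  separation a b = demand 1 a b ⊔ demand 2 a b ⊔ demand 3 a b

  module _ {n : ℕ} {G : Graph n} (e : ℕ → Fin n)
           (e-hom : ∀ {a c} → a < m → c < m → D ∣ a - c ∣ → G (e a) (e c)) where

    reachable⇒walk : ∀ l {a b} → a < m → T (reachable l a b) → Walk G (e a) (e b) l
    reachable⇒walk zero {a} {b} a<m a≡ᵇb rewrite ≡ᵇ⇒≡ a b a≡ᵇb = here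
    reachable⇒walk (suc l) {a} a<m r with find (any⁻ _ (upTo m) r)
    ... | c , c∈upTo , adj∧r with Equivalence.to T-∧ adj∧r
    ...   | adj , r′ = step (e-hom a<m c<m (toWitness adj)) (reachable⇒walk l c<m r′)
      where c<m = ∈-upTo⁻ c∈upTo

    separation≤gap : (∀ x y → Dec (G x y)) → ∀ {f} → IsL321 G f →
                     (∀ {a c} → a < m → c < m → e a ≡ e c → a ≡ c) →
                     ∀ {a c} → a < m → c < m → a ≢ c →
                     separation a c ≤ ∣ f (e a) - f (e c) ∣
    separation≤gap G? {f} L e-inj {a} {c} a<m c<m a≢c =
      ⊔-lub (⊔-lub (demand≤gap 1) (demand≤gap 2)) (demand≤gap 3)
      where
        demand≤gap : ∀ l → demand l a c ≤ ∣ f (e a) - f (e c) ∣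
        demand≤gap l with reachable l a c in r
        ... | false = z≤n
        ... | true  = m≤n+o⇒m∸n≤o 4 l (subst (4 ≤_) (+-comm _ l) bound)
          where
            bound = IsL321⇒walk-gap G? {f} L (a≢c ∘ e-inj a<m c<m) l
                                    (reachable⇒walk l a<m (subst T (sym r) _))

-- Positions are labelled in the order 0, 1, 2, …; the labels chosen so far are
-- kept newest first, and row k of the table lists sep k a for a = k − 1, …, 0,
-- aligned with them.  Tabulating sep lets the search evaluate it only once.
fits : List ℕ → List ℕ → ℕ → Bool
fits (s ∷ ss) (u ∷ us) v = (s ≤ᵇ ∣ v - u ∣) ∧ fits ss us v
fits _        _        _ = true

table : (ℕ → ℕ → ℕ) → ℕ → ℕ → List (List ℕ)
table sep k zero    = []
table sep k (suc r) = applyDownFrom (sep k) k ∷ table sep (suc k) r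

refute : ℕ → List (List ℕ) → List ℕ → Bool
refute b []           labels = false
refute b (row ∷ rows) labels =
  all (λ v → if fits row labels v then refute b rows (v ∷ labels) else true) (upTo b)

fits-complete : ∀ {h g v} j → (∀ {a} → a < j → h a ≤ ∣ v - g a ∣) →
                T (fits (applyDownFrom h j) (applyDownFrom g j) v)
fits-complete zero    _  = _
fits-complete (suc j) ok =
  Equivalence.from T-∧ (≤⇒≤ᵇ (ok (n<1+n j)) , fits-complete j (ok ∘ m<n⇒m<1+n))

refute-sound : ∀ {sep b} g k r → (∀ {c} → c < k + r → g c < b) →
               (∀ {a c} → a < c → c < k + r → sep c a ≤ ∣ g c - g a ∣) →
               ¬ T (refute b (table sep k r) (applyDownFrom g k))
refute-sound g k zero    _       _         ()
refute-sound {sep} {b} g k (suc r) bounded separated refuted =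
  refute-sound g (suc k) r (bounded ∘ shift) (λ a<c → separated a<c ∘ shift)
    (take-then (fits-complete k (λ a<k → separated a<k k<k+r))
               (All.lookup (all⁺ _ (upTo b) refuted) (∈-upTo⁺ (bounded k<k+r))))
  where
    shift : ∀ {c} → c < suc k + r → c < k + suc r
    shift {c} = subst (c <_) (sym (+-suc k r))
    k<k+r : k < k + suc r
    k<k+r = m<m+n k z<s
    take-then : ∀ {x y} → T x → T (if x then y else true) → T y
    take-then {true} _ t = t

∣m∸o-n∸o∣≡∣m-n∣ : ∀ {m n o} → o ≤ m → o ≤ n → ∣ m ∸ o - n ∸ o ∣ ≡ ∣ m - n ∣
∣m∸o-n∸o∣≡∣m-n∣ {m} {n} {o} o≤m o≤n = begin
  ∣ m ∸ o - n ∸ o ∣               ≡⟨ ∣m+n-m+o∣≡∣n-o∣ o (m ∸ o) (n ∸ o) ⟨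
  ∣ o + (m ∸ o) - o + (n ∸ o) ∣   ≡⟨ cong₂ ∣_-_∣ (m+[n∸m]≡n o≤m) (m+[n∸m]≡n o≤n) ⟩
  ∣ m - n ∣                       ∎
  where open ≡-Reasoning

Spread : ∀ {n} → (Fin n → ℕ) → ℕ → Set
Spread {n} f b = Σ (Fin n) (λ x → Σ (Fin n) (λ y → f y + b ≤ f x))

Narrow : ∀ {n} → (Fin n → ℕ) → ℕ → Set
Narrow f b = ∃ λ v → ∀ x → f v ≤ f x × f x < f v + b

Spread⊎Narrow : ∀ {n} (f : Fin (suc n) → ℕ) b → Spread f b ⊎ Narrow f b
Spread⊎Narrow {n} f b = decide (f v₀ + b ≤? f v₁)
  where
    v₀ = argmin f Fin.zero (allFin (suc n))
    v₁ = argmax f Fin.zero (allFin (suc n))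
    lower : ∀ x → f v₀ ≤ f x
    lower x = All.lookup (f[argmin]≤f[xs] {f = f} Fin.zero (allFin (suc n))) (∈-allFin x)
    upper : ∀ x → f x ≤ f v₁
    upper x = All.lookup (f[xs]≤f[argmax] {f = f} Fin.zero (allFin (suc n))) (∈-allFin x)
    decide : Dec (f v₀ + b ≤ f v₁) → Spread f b ⊎ Narrow f b
    decide (yes wide)  = inj₁ (v₁ , v₀ , wide)
    decide (no narrow) = inj₂ (v₀ , λ x → lower x , ≤-<-trans (upper x) (≰⇒> narrow))

-- Position 0 is given label 0: it will carry the minimum label.
WindowUnlabellable : ∀ {D} → Decidable D → ℕ → ℕ → Set
WindowUnlabellable D? m b =
  refute b (table (Window.separation D? m) 1 (m ∸ 1)) (0 ∷ []) ≡ true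

Narrow⇒¬WindowUnlabellable : ∀ {n D} (D? : Decidable D) → 4 ≤ n → (∀ {d} → D d → Jump n d) →
  ∀ {m} → m ≤ n → ∀ {b} (f : Fin n → ℕ) → IsL321 (C14 n) f →
  Narrow f b → ¬ WindowUnlabellable D? m b
Narrow⇒¬WindowUnlabellable {suc n} D? 4≤n D⇒Jump {suc w} w<n {b} f L (v , within) refuted =
  refute-sound g 1 w g<b separated
    (subst (λ z → T (refute b (table separation 1 w) (z ∷ []))) (sym g0≡0)
           (Equivalence.from T-≡ refuted))
  where
    open Rotation (suc n) v
    open Window D? (suc w)
    μ≤ : ∀ x → f v ≤ f x
    μ≤ x = proj₁ (within x)
    g : ℕ → ℕ
    g a = f (rotate a) ∸ f v
    g0≡0 : g 0 ≡ 0
    g0≡0 = trans (cong (λ x → f x ∸ f v) rotate-zero) (n∸n≡0 (f v))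
    g<b : ∀ {c} → c < suc w → g c < b
    g<b {c} _ = +-cancelˡ-< (f v) (g c) b
      (subst (_< f v + b) (sym (m+[n∸m]≡n (μ≤ (rotate c)))) (proj₂ (within (rotate c))))
    inWindow : ∀ {a} → a < suc w → a < suc n
    inWindow a<w = ≤-trans a<w w<n
    separated : ∀ {a c} → a < c → c < suc w → separation c a ≤ ∣ g c - g a ∣
    separated {a} {c} a<c c<w =
      subst (separation c a ≤_) (sym (∣m∸o-n∸o∣≡∣m-n∣ (μ≤ _) (μ≤ _)))
        (separation≤gap rotate
          (λ a<w c<w → rotate-Jump⇒C14 4≤n (inWindow a<w) (inWindow c<w) ∘ D⇒Jump)
          (C14? (suc n)) {f} L
          (λ a<w c<w → rotate-injective (inWindow a<w) (inWindow c<w))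
          c<w (<-trans a<c c<w) (>⇒≢ a<c))

WindowUnlabellable⇒Spread : ∀ {n D} (D? : Decidable D) → 4 ≤ n → (∀ {d} → D d → Jump n d) →
  ∀ m → m ≤ n → ∀ b → WindowUnlabellable D? m b →
  (f : Fin n → ℕ) → IsL321 (C14 n) f → Spread f b
WindowUnlabellable⇒Spread {suc n} D? 4≤n D⇒Jump m m≤n b refuted f L =
  [ id , (λ narrow → ⊥-elim (Narrow⇒¬WindowUnlabellable D? 4≤n D⇒Jump m≤n f L narrow refuted)) ]′
  (Spread⊎Narrow f b)

long-window-unlabellable : WindowUnlabellable short? 14 15
long-window-unlabellable = refl

small-cycle-unlabellable : ∀ {k} → k < 5 → WindowUnlabellable (jump? (9 + k)) (9 + k) 15
small-cycle-unlabellable {0} _ = refl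
small-cycle-unlabellable {1} _ = refl
small-cycle-unlabellable {2} _ = refl
small-cycle-unlabellable {3} _ = refl
small-cycle-unlabellable {4} _ = refl
small-cycle-unlabellable {suc (suc (suc (suc (suc _))))} (s≤s (s≤s (s≤s (s≤s (s≤s ())))))

-- The implicit arguments are given so that the search results are matched
-- syntactically; inferring them would make Agda run the search on a symbolic n.
mainTheorem7 : (n : ℕ) → 9 ≤ n → (f : Fin n → ℕ) → IsL321 (C14 n) f →
    Σ (Fin n) (λ x → Σ (Fin n) (λ y → f y + 15 ≤ f x))
mainTheorem7 n 9≤n f L with 14 ≤? n
... | yes 14≤n =
  WindowUnlabellable⇒Spread {n} {Short} short? (≤-trans (m≤m+n 4 5) 9≤n) (Short⇒Jump {n})
    14 14≤n 15 long-window-unlabellable f L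
... | no 14≰n with n ∸ 9 | m+[n∸m]≡n 9≤n
...   | k | refl =
  WindowUnlabellable⇒Spread {9 + k} {Jump (9 + k)} (jump? (9 + k)) (≤-trans (m≤m+n 4 5) 9≤n) id
    (9 + k) ≤-refl 15 (small-cycle-unlabellable {k} (+-cancelˡ-< 9 k 5 (≰⇒> 14≰n))) f L
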